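{- Let $n\ge 5$ and $T_{5,n}=C_5\Box C_n$. Then $\chi(T_{5,n}^2)=5$ if $n\equiv 0\pmod 5$; $\chi(T_{5,7}^2)=7$; and $\chi(T_{5,n}^2)=6$ otherwise (i.e. if $n\not\equiv 0\pmod 5$ and $n\ne 7$).
   Context: $C_j$ denotes the cycle on $j$ vertices; $\Box$ is the Cartesian product of graphs. The square $G^2$ of a graph $G$ has vertex set $V(G)$, two distinct vertices being adjacent iff their distance in $G$ is at most 2. $\chi$ is the chromatic number. -}

module Defs where

open import Level using (0ℓ)
open import Data.Nat using (ℕ; zero; suc; _+_; _≤_; _<_; _%_)
open import Data.Fin using (Fin; toℕ)
open import Data.Product using (Σ; _×_; ∃; ∃-syntax; _,_)
open import Data.Sum using (_⊎_)
open import Relation.Nullary using (¬_)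
open import Relation.Binary.PropositionalEquality using (_≡_; _≢_)

record Graph : Set₁ where
  field
    Vertex : Set
    Adj    : Vertex → Vertex → Set
open Graph public

-- The cycle C_j on vertex set Fin j: i adjacent to i+1 (mod j) and vice versa.
-- (Meaningful as a simple cycle for j ≥ 3.)
Cycle : (j : ℕ) → Graph
Cycle j = record
  { Vertex = Fin j
  ; Adj    = λ a b → (toℕ b ≡ (suc (toℕ a)) % suc (predℕ j)) ⊎ (toℕ a ≡ (suc (toℕ b)) % suc (predℕ j))
  }
  where
    predℕ : ℕ → ℕ
    predℕ zero = zero
    predℕ (suc k) = k

_□_ : Graph → Graph → Graph
G □ H = record
  { Vertex = Vertex G × Vertex H
  ; Adj    = λ { (g , h) (g' , h') →
               (Adj G g g' × h ≡ h') ⊎ (g ≡ g' × Adj H h h') }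
  }

square : Graph → Graph
square G = record
  { Vertex = Vertex G
  ; Adj    = λ u v → u ≢ v × (Adj G u v ⊎ ∃[ w ] (Adj G u w × Adj G w v))
  }

Colourable : Graph → ℕ → Set
Colourable G k = Σ (Vertex G → Fin k) (λ c → ∀ (u v : Vertex G) → Adj G u v → c u ≢ c v)

ChromaticNumber : Graph → ℕ → Set
ChromaticNumber G k = Colourable G k × (∀ m → m < k → ¬ Colourable G m)

T5 : ℕ → Graph
T5 n = Cycle 5 □ Cycle n

-- A vertex is (row r ∈ C_5, column j ∈ C_n); two
-- vertices are at distance ≤ 2 iff they share a column, lie in neighbouring
-- columns with near rows, or lie two columns apart in one row (Torus.Close).
--
-- Upper bounds: a cyclic word of columns, every three consecutive ones being
-- compatible, is a colouring; words with common starting columns glue.  The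
-- standard word (row r of column i gets r + 2i mod 5), repeated, and a few
-- explicit tail words, checked by evaluation, give 5, 6 and 7 colours.
-- Lower bounds: a column is a 5-clique.  One colour class, followed along the
-- columns, advances by a constant jump s ∈ {2, 3} of rows (uniform-jump); with
-- 5 colours it meets every column, so going around once gives 5 ∣ s·n, i.e.
-- 5 ∣ n.  For n = 7 a count of missing colours excludes 6 colours.
-- theorem7 combines these bounds.
module Submission where

open import Defs
open import Data.Nat using (ℕ; zero; suc; _+_; _*_; _∸_; _/_; _≤_; _<_; _%_; z≤n; s≤s; _<?_)
import Data.Nat as ℕ
open import Data.Nat.Properties
  using ( +-comm; +-suc; +-identityʳ; *-zeroʳ; *-suc; ≤-refl; ≤-trans; <⇒≤; <⇒≢; <⇒≱; n≤1+n; m≤n+m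
        ; m<m+n; 1+n≰n; m+[n∸m]≡n; +-monoˡ-≤; ≮⇒≥; m≤n⇒∃[o]m+o≡n; +-cancelˡ-<; m≤n⇒m<n∨m≡n
        ; m≤n⇒m≤1+n; allUpTo? )
open import Data.Nat.DivMod using (m%n<n; m<n⇒m%n≡m; n%n≡0; [m+n]%n≡m%n; %-distribˡ-+; m%n%n≡m%n; m≡m%n+[m/n]*n)
open import Data.Nat.Divisibility using (_∣_; _∣?_; m%n≡0⇒n∣m; n∣m⇒m%n≡0)
open import Data.Nat.Primality using (prime?; euclidsLemma)
open import Data.Fin using (Fin; zero; suc; toℕ; fromℕ<; #_; splitAt; join)
open import Data.Fin.Properties using (toℕ-fromℕ<; toℕ-injective; toℕ<n; all?; any?; injective⇒≤; join-splitAt)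
  renaming (_≟_ to _≟ᶠ_)
open import Data.Vec using (Vec; lookup; _∷_; [])
open import Data.Product using (Σ; ∃; ∃-syntax; _×_; _,_; proj₁; proj₂)
open import Data.Sum using (_⊎_; inj₁; inj₂; [_,_])
open import Data.Empty using (⊥; ⊥-elim)
open import Function using (_∘_)
open import Function.Definitions using (Injective)
open import Relation.Nullary using (¬_; Dec; yes; no)
open import Relation.Nullary.Decidable using (True; toWitness; from-yes; from-no; _⊎-dec_; _×-dec_; _→-dec_; ¬?)
open import Relation.Binary.PropositionalEquality hiding ([_])

module CycleFacts (k : ℕ) where

  N : ℕ
  N = suc k

  open import Function.Endo.Propositional (Fin N) public using (_^_; ^-homo)

  next : Fin N → Fin N
  next j = fromℕ< (m%n<n (suc (toℕ j)) N)

  toℕ-next : ∀ j → toℕ (next j) ≡ suc (toℕ j) % N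
  toℕ-next j = toℕ-fromℕ< (m%n<n (suc (toℕ j)) N)

  adj⇒next : ∀ {a b} → Adj (Cycle N) a b → b ≡ next a ⊎ a ≡ next b
  adj⇒next {a} {b} (inj₁ e) = inj₁ (toℕ-injective (trans e (sym (toℕ-next a))))
  adj⇒next {a} {b} (inj₂ e) = inj₂ (toℕ-injective (trans e (sym (toℕ-next b))))

  adj-next : ∀ a → Adj (Cycle N) a (next a)
  adj-next a = inj₁ (toℕ-next a)

  suc-% : ∀ m → suc (m % N) % N ≡ suc m % N
  suc-% m = begin
    (1 + m % N) % N            ≡⟨ %-distribˡ-+ 1 (m % N) N ⟩
    (1 % N + m % N % N) % N    ≡⟨ cong (λ x → (1 % N + x) % N) (m%n%n≡m%n m N) ⟩
    (1 % N + m % N) % N        ≡⟨ %-distribˡ-+ 1 m N ⟨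
    (1 + m) % N                ∎
    where open ≡-Reasoning

  toℕ-next^ : ∀ i j → toℕ ((next ^ i) j) ≡ (toℕ j + i) % N
  toℕ-next^ zero j = sym (trans (cong (_% N) (+-comm (toℕ j) 0)) (m<n⇒m%n≡m (toℕ<n j)))
  toℕ-next^ (suc i) j = begin
    toℕ (next ((next ^ i) j))      ≡⟨ toℕ-next _ ⟩
    suc (toℕ ((next ^ i) j)) % N   ≡⟨ cong (λ x → suc x % N) (toℕ-next^ i j) ⟩
    suc ((toℕ j + i) % N) % N      ≡⟨ suc-% (toℕ j + i) ⟩
    suc (toℕ j + i) % N            ≡⟨ cong (_% N) (+-suc (toℕ j) i) ⟨
    (toℕ j + suc i) % N            ∎
    where open ≡-Reasoning

  next^-N : ∀ j → (next ^ N) j ≡ j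
  next^-N j = toℕ-injective (begin
    toℕ ((next ^ N) j) ≡⟨ toℕ-next^ N j ⟩
    (toℕ j + N) % N    ≡⟨ [m+n]%n≡m%n (toℕ j) N ⟩
    toℕ j % N          ≡⟨ m<n⇒m%n≡m (toℕ<n j) ⟩
    toℕ j              ∎)
    where open ≡-Reasoning

  next^-comm : ∀ i a j → (next ^ i) ((next ^ a) j) ≡ (next ^ a) ((next ^ i) j)
  next^-comm i a j = begin
    (next ^ i) ((next ^ a) j)   ≡⟨ cong-app (^-homo next i a) j ⟨
    (next ^ (i + a)) j          ≡⟨ cong (λ m → (next ^ m) j) (+-comm i a) ⟩
    (next ^ (a + i)) j          ≡⟨ cong-app (^-homo next a i) j ⟩
    (next ^ a) ((next ^ i) j)   ∎
    where open ≡-Reasoning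

  -- If i steps fix some vertex, then i is a multiple of N: move the fixed
  -- vertex to 0 (the i-step map commutes with that move) and read off i mod N.
  next^-fixed : ∀ i j → (next ^ i) j ≡ j → i % N ≡ 0
  next^-fixed i j fixed = trans (sym (toℕ-next^ i zero)) (cong toℕ fixes-zero)
    where
      a : ℕ
      a = N ∸ toℕ j
      j↦zero : (next ^ a) j ≡ zero
      j↦zero = toℕ-injective (begin
        toℕ ((next ^ a) j)           ≡⟨ toℕ-next^ a j ⟩
        (toℕ j + (N ∸ toℕ j)) % N   ≡⟨ cong (_% N) (m+[n∸m]≡n (<⇒≤ (toℕ<n j))) ⟩
        N % N                        ≡⟨ n%n≡0 N ⟩
        0                            ∎)
        where open ≡-Reasoning
      fixes-zero : (next ^ i) zero ≡ zero
      fixes-zero = begin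
        (next ^ i) zero                ≡⟨ cong (next ^ i) j↦zero ⟨
        (next ^ i) ((next ^ a) j)      ≡⟨ next^-comm i a j ⟩
        (next ^ a) ((next ^ i) j)      ≡⟨ cong (next ^ a) fixed ⟩
        (next ^ a) j                   ≡⟨ j↦zero ⟩
        zero                           ∎
        where open ≡-Reasoning

  next^-moves : ∀ i j → 0 < i → i < N → (next ^ i) j ≢ j
  next^-moves i j 0<i i<N fixed = <⇒≢ 0<i (sym (trans (sym (m<n⇒m%n≡m i<N)) (next^-fixed i j fixed)))

  -- The successor map is injective: k more steps undo it.
  next-injective : ∀ {a b} → next a ≡ next b → a ≡ b
  next-injective {a} {b} e = trans (sym (back a)) (trans (cong (next ^ k) e) (back b))
    where
      back : ∀ j → (next ^ k) (next j) ≡ j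
      back j = begin
        (next ^ k) ((next ^ 1) j)   ≡⟨ cong-app (^-homo next k 1) j ⟨
        (next ^ (k + 1)) j          ≡⟨ cong (λ m → (next ^ m) j) (+-comm k 1) ⟩
        (next ^ N) j                ≡⟨ next^-N j ⟩
        j                           ∎
        where open ≡-Reasoning

  next^-multiple : ∀ q j → (next ^ (q * N)) j ≡ j
  next^-multiple zero    j = refl
  next^-multiple (suc q) j = begin
    (next ^ (N + q * N)) j          ≡⟨ cong-app (^-homo next N (q * N)) j ⟩
    (next ^ N) ((next ^ (q * N)) j) ≡⟨ cong (next ^ N) (next^-multiple q j) ⟩
    (next ^ N) j                    ≡⟨ next^-N j ⟩
    j                               ∎
    where open ≡-Reasoning

C5 : Graph
C5 = Cycle 5

module Row = CycleFacts 4

rotate : ℕ → Fin 5 → Fin 5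
rotate s = Row._^_ Row.next s

rotate-+ : ∀ s t p → rotate (s + t) p ≡ rotate s (rotate t p)
rotate-+ s t p = cong-app (Row.^-homo Row.next s t) p

adj? : ∀ r r' → Dec (Adj C5 r r')
adj? r r' = (toℕ r' ℕ.≟ _) ⊎-dec (toℕ r ℕ.≟ _)

-- Rows in neighbouring columns at distance ≤ 2 in the torus: equal or adjacent.
Near : Fin 5 → Fin 5 → Set
Near r r' = r ≡ r' ⊎ Adj C5 r r'

near? : ∀ r r' → Dec (Near r r')
near? r r' = (r ≟ᶠ r') ⊎-dec adj? r r'

square-C5-complete : ∀ r r' → r ≢ r' → Adj C5 r r' ⊎ ∃[ w ] (Adj C5 r w × Adj C5 w r')
square-C5-complete = toWitness {a? = all? λ r → all? λ r' →
  ¬? (r ≟ᶠ r') →-dec (adj? r r' ⊎-dec any? λ w → adj? r w ×-dec adj? w r')} _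

IsJump : ℕ → Set
IsJump s = s ≡ 2 ⊎ s ≡ 3

far⇒two-or-three : ∀ p q → ¬ Near p q → q ≡ rotate 2 p ⊎ q ≡ rotate 3 p
far⇒two-or-three = toWitness {a? = all? λ p → all? λ q →
  ¬? (near? p q) →-dec ((q ≟ᶠ rotate 2 p) ⊎-dec (q ≟ᶠ rotate 3 p))} _

far⇒jump : ∀ p q → ¬ Near p q → Σ ℕ λ s → IsJump s × q ≡ rotate s p
far⇒jump p q far with far⇒two-or-three p q far
... | inj₁ e = 2 , inj₁ refl , e
... | inj₂ e = 3 , inj₂ refl , e

-- Two different jumps add up to a full turn, so a row that is left by one
-- jump and then another one is returned to.
jumps-agree : ∀ {s t} p → IsJump s → IsJump t → p ≢ rotate t (rotate s p) → s ≡ t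
jumps-agree p (inj₁ refl) (inj₁ refl) _ = refl
jumps-agree p (inj₂ refl) (inj₂ refl) _ = refl
jumps-agree p (inj₁ refl) (inj₂ refl) moved = ⊥-elim (moved (sym (Row.next^-N p)))
jumps-agree p (inj₂ refl) (inj₁ refl) moved = ⊥-elim (moved (sym (Row.next^-N p)))

-- A sequence of rows in which consecutive rows are not near and rows two
-- apart differ advances by one constant jump s: row i = rotate (s·i) (row 0).
-- (Each step is a jump; two consecutive jumps agree by jumps-agree.)
uniform-jump : ∀ m (row : ℕ → Fin 5)
  → (∀ i → i < m → ¬ Near (row i) (row (suc i)))
  → (∀ i → suc i < m → row i ≢ row (suc (suc i)))
  → Σ ℕ λ s → IsJump s × (∀ i → i ≤ m → row i ≡ rotate (s * i) (row 0))
uniform-jump zero row _ _ = 2 , inj₁ refl , λ { zero _ → refl }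
uniform-jump (suc m) row far apart = s , s-jump , position
  where
    first : Σ ℕ λ s → IsJump s × row 1 ≡ rotate s (row 0)
    first = far⇒jump (row 0) (row 1) (far 0 (s≤s z≤n))
    s : ℕ
    s = proj₁ first
    s-jump : IsJump s
    s-jump = proj₁ (proj₂ first)

    step : ∀ i → i < suc m → row (suc i) ≡ rotate s (row i)
    step zero    _ = proj₂ (proj₂ first)
    step (suc i) i+1<1+m with far⇒jump (row (suc i)) (row (suc (suc i))) (far (suc i) i+1<1+m)
    ... | t , t-jump , next-row = trans next-row (cong (λ x → rotate x (row (suc i))) (sym s≡t))
      where
        s≡t : s ≡ t
        s≡t = jumps-agree (row i) s-jump t-jump λ back → apart i i+1<1+m (begin
          row i                         ≡⟨ back ⟩
          rotate t (rotate s (row i))   ≡⟨ cong (rotate t) (step i (<⇒≤ i+1<1+m)) ⟨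
          rotate t (row (suc i))        ≡⟨ next-row ⟨
          row (suc (suc i))             ∎)
          where open ≡-Reasoning

    position : ∀ i → i ≤ suc m → row i ≡ rotate (s * i) (row 0)
    position zero    _ = cong (λ x → rotate x (row 0)) (sym (*-zeroʳ s))
    position (suc i) i+1≤1+m = begin
      row (suc i)                         ≡⟨ step i i+1≤1+m ⟩
      rotate s (row i)                    ≡⟨ cong (rotate s) (position i (<⇒≤ i+1≤1+m)) ⟩
      rotate s (rotate (s * i) (row 0))   ≡⟨ rotate-+ s (s * i) (row 0) ⟨
      rotate (s + s * i) (row 0)          ≡⟨ cong (λ x → rotate x (row 0)) (*-suc s i) ⟨
      rotate (s * suc i) (row 0)          ∎
      where open ≡-Reasoning

near-sym : ∀ {r r'} → Near r r' → Near r' r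
near-sym (inj₁ e) = inj₁ (sym e)
near-sym (inj₂ (inj₁ e)) = inj₂ (inj₂ e)
near-sym (inj₂ (inj₂ e)) = inj₂ (inj₁ e)

-- Conditions on three consecutive columns a, b, d (each a colouring of the
-- five rows) for the square of the torus: rows inside a column, near rows in
-- neighbouring columns and equal rows two columns apart get distinct colours.
Compatible : ∀ {c} → (a b d : Fin 5 → Fin c) → Set
Compatible a b d = (∀ r r' → r ≢ r' → a r ≢ a r')
                 × (∀ r r' → Near r r' → a r ≢ b r')
                 × (∀ r → a r ≢ d r)

module Torus (k : ℕ) where
  open CycleFacts k public

  G : Graph
  G = square (T5 N)

  data Close : Vertex G → Vertex G → Set where
    same-column   : ∀ {r r' j} → r ≢ r' → Close (r , j) (r' , j)
    next-column   : ∀ {r r' j} → Near r r' → Close (r , j) (r' , next j)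
    second-column : ∀ {r j} → Close (r , j) (r , next (next j))

  adj⇒close : ∀ u v → Adj G u v → Close u v ⊎ Close v u
  adj⇒close (r , j) (r' , .j) (u≢v , inj₁ (inj₁ (_ , refl))) =
    inj₁ (same-column λ e → u≢v (cong (_, j) e))
  adj⇒close (r , j) (.r , j') (u≢v , inj₁ (inj₂ (refl , jj'))) with adj⇒next jj'
  ... | inj₁ refl = inj₁ (next-column (inj₁ refl))
  ... | inj₂ refl = inj₂ (next-column (inj₁ refl))
  adj⇒close (r , j) (r' , .j) (u≢v , inj₂ (_ , inj₁ (_ , refl) , inj₁ (_ , refl))) =
    inj₁ (same-column λ e → u≢v (cong (_, j) e))
  adj⇒close (r , j) (r' , j') (u≢v , inj₂ (_ , inj₁ (rr' , refl) , inj₂ (refl , jj'))) with adj⇒next jj'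
  ... | inj₁ refl = inj₁ (next-column (inj₂ rr'))
  ... | inj₂ refl = inj₂ (next-column (near-sym (inj₂ rr')))
  adj⇒close (r , j) (r' , j') (u≢v , inj₂ (_ , inj₂ (refl , jj') , inj₁ (rr' , refl))) with adj⇒next jj'
  ... | inj₁ refl = inj₁ (next-column (inj₂ rr'))
  ... | inj₂ refl = inj₂ (next-column (near-sym (inj₂ rr')))
  adj⇒close (r , j) (.r , j') (u≢v , inj₂ (_ , inj₂ (refl , jw) , inj₂ (refl , wj'))) with adj⇒next jw | adj⇒next wj'
  ... | inj₁ refl | inj₁ refl = inj₁ second-column
  ... | inj₁ refl | inj₂ e    = ⊥-elim (u≢v (cong (r ,_) (next-injective e)))
  ... | inj₂ refl | inj₁ e    = ⊥-elim (u≢v (cong (r ,_) (sym e)))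
  ... | inj₂ refl | inj₂ refl = inj₂ second-column

  next-moves : 2 ≤ k → ∀ j → next j ≢ j
  next-moves k≥2 j = next^-moves 1 j (s≤s z≤n) (s≤s (≤-trans (n≤1+n 1) k≥2))

  next²-moves : 2 ≤ k → ∀ j → next (next j) ≢ j
  next²-moves k≥2 j = next^-moves 2 j (s≤s z≤n) (s≤s k≥2)

  close⇒adj : 2 ≤ k → ∀ {u v} → Close u v → Adj G u v
  close⇒adj _ {r , j} {r' , _} (same-column r≢r') with square-C5-complete r r' r≢r'
  ... | inj₁ rr'            = r≢r' ∘ cong proj₁ , inj₁ (inj₁ (rr' , refl))
  ... | inj₂ (w , rw , wr') = r≢r' ∘ cong proj₁ , inj₂ ((w , j) , inj₁ (rw , refl) , inj₁ (wr' , refl))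
  close⇒adj k≥2 {r , j} (next-column (inj₁ refl)) =
    next-moves k≥2 j ∘ sym ∘ cong proj₂ , inj₁ (inj₂ (refl , adj-next j))
  close⇒adj k≥2 {r , j} {r' , _} (next-column (inj₂ rr')) =
    next-moves k≥2 j ∘ sym ∘ cong proj₂ , inj₂ ((r' , j) , inj₁ (rr' , refl) , inj₂ (refl , adj-next j))
  close⇒adj k≥2 {r , j} second-column =
    next²-moves k≥2 j ∘ sym ∘ cong proj₂ , inj₂ ((r , next j) , inj₂ (refl , adj-next j) , inj₂ (refl , adj-next (next j)))

  column-colouring : ∀ {c} (col : Fin N → Fin 5 → Fin c)
    → (∀ j → Compatible (col j) (col (next j)) (col (next (next j))))
    → Colourable G c
  column-colouring {c} col compatible = colour , proper
    where
      colour : Vertex G → Fin c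
      colour (r , j) = col j r
      close-distinct : ∀ {u v} → Close u v → colour u ≢ colour v
      close-distinct {r , j} (same-column r≢r') = proj₁ (compatible j) _ _ r≢r'
      close-distinct {r , j} (next-column near) = proj₁ (proj₂ (compatible j)) _ _ near
      close-distinct {r , j} second-column      = proj₂ (proj₂ (compatible j)) r
      proper : ∀ u v → Adj G u v → colour u ≢ colour v
      proper u v uv with adj⇒close u v uv
      ... | inj₁ uv′ = close-distinct uv′
      ... | inj₂ vu  = λ e → close-distinct vu (sym e)

compatible? : ∀ {c} (a b d : Fin 5 → Fin c) → Dec (Compatible a b d)
compatible? a b d =
        (all? λ r → all? λ r' → ¬? (r ≟ᶠ r') →-dec ¬? (a r ≟ᶠ a r'))
  ×-dec (all? λ r → all? λ r' → near? r r' →-dec ¬? (a r ≟ᶠ b r'))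
  ×-dec (all? λ r → ¬? (a r ≟ᶠ d r))

Column : ℕ → Set
Column c = Vec (Fin c) 5

CompatibleAt : ∀ {c} → (ℕ → Column c) → ℕ → Set
CompatibleAt w x = Compatible (lookup (w x)) (lookup (w (suc x))) (lookup (w (suc (suc x))))

compatibleAt? : ∀ {c} (w : ℕ → Column c) x → Dec (CompatibleAt w x)
compatibleAt? w x = compatible? (lookup (w x)) (lookup (w (suc x))) (lookup (w (suc (suc x))))

compatible-cong : ∀ {c} {a b d a' b' d' : Column c} → a ≡ a' → b ≡ b' → d ≡ d'
  → Compatible (lookup a) (lookup b) (lookup d) → Compatible (lookup a') (lookup b') (lookup d')
compatible-cong refl refl refl p = p

-- A cyclic word of length n: columns 0 … n+1 where every window of three
-- consecutive columns starting before n is compatible, and the word closes up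
-- (columns n, n+1 repeat the starting columns a, b).
record CyclicWord (c n : ℕ) (a b : Column c) : Set where
  field
    column     : ℕ → Column c
    compatible : ∀ {x} → x < n → CompatibleAt column x
    start₀     : column 0 ≡ a
    start₁     : column 1 ≡ b
    end₀       : column n ≡ a
    end₁       : column (suc n) ≡ b
open CyclicWord

word-colouring : ∀ {c n a b} → CyclicWord c n a b → Colourable (square (T5 n)) c
word-colouring {n = zero} w = (λ { (_ , ()) }) , λ { (_ , ()) }
word-colouring {c} {suc k} w =
  column-colouring (λ j → lookup (col (toℕ j))) compatible-at
  where
    open Torus k
    col : ℕ → Column c
    col = column w

    ends : ∀ i → i ≤ 1 → col (i + N) ≡ col i
    ends zero    _         = trans (end₀ w) (sym (start₀ w))
    ends (suc _) (s≤s z≤n) = trans (end₁ w) (sym (start₁ w))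

    col-mod : ∀ i y → i ≤ 1 → y ≤ N → col (i + y % N) ≡ col (i + y)
    col-mod i y i≤1 y≤N with m≤n⇒m<n∨m≡n y≤N
    ... | inj₁ y<N  = cong (λ x → col (i + x)) (m<n⇒m%n≡m y<N)
    ... | inj₂ refl = begin
      col (i + N % N)   ≡⟨ cong (λ x → col (i + x)) (n%n≡0 N) ⟩
      col (i + 0)       ≡⟨ cong col (+-identityʳ i) ⟩
      col i             ≡⟨ ends i i≤1 ⟨
      col (i + N)       ∎
      where open ≡-Reasoning

    one-step : ∀ j → col (toℕ (next j)) ≡ col (suc (toℕ j))
    one-step j = trans (cong col (toℕ-next j)) (col-mod 0 (suc (toℕ j)) z≤n (toℕ<n j))

    two-steps : ∀ j → col (toℕ (next (next j))) ≡ col (suc (suc (toℕ j)))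
    two-steps j = begin
      col (toℕ (next (next j)))        ≡⟨ one-step (next j) ⟩
      col (suc (toℕ (next j)))         ≡⟨ cong (col ∘ suc) (toℕ-next j) ⟩
      col (suc (suc (toℕ j) % N))      ≡⟨ col-mod 1 (suc (toℕ j)) (s≤s z≤n) (toℕ<n j) ⟩
      col (suc (suc (toℕ j)))          ∎
      where open ≡-Reasoning

    compatible-at : ∀ j → Compatible (lookup (col (toℕ j))) (lookup (col (toℕ (next j))))
                                     (lookup (col (toℕ (next (next j)))))
    compatible-at j = compatible-cong {a = col (toℕ j)} refl (sym (one-step j)) (sym (two-steps j)) (compatible w (toℕ<n j))

prepend : ∀ {A : Set} → ℕ → (ℕ → A) → (ℕ → A) → ℕ → A
prepend zero    u v       = v
prepend (suc m) u v zero    = u zero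
prepend (suc m) u v (suc x) = prepend m (u ∘ suc) v x

prepend-right : ∀ {A : Set} m (u v : ℕ → A) x → prepend m u v (m + x) ≡ v x
prepend-right zero    u v x = refl
prepend-right (suc m) u v x = prepend-right m (u ∘ suc) v x

prepend-left : ∀ {A : Set} m (u v : ℕ → A) → u m ≡ v 0 → u (suc m) ≡ v 1
  → ∀ {x} → x < 2 + m → prepend m u v x ≡ u x
prepend-left zero    u v e₀ e₁ {zero}  _ = sym e₀
prepend-left zero    u v e₀ e₁ {suc zero} _ = sym e₁
prepend-left zero    u v e₀ e₁ {suc (suc x)} (s≤s (s≤s ()))
prepend-left (suc m) u v e₀ e₁ {zero}  _ = refl
prepend-left (suc m) u v e₀ e₁ {suc x} (s≤s x<2+m) = prepend-left m (u ∘ suc) v e₀ e₁ x<2+m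

glue : ∀ {c m t a b} → CyclicWord c m a b → CyclicWord c t a b → CyclicWord c (m + t) a b
glue {c} {m} {t} u v = record
  { column     = col
  ; compatible = compatible′
  ; start₀     = trans (agree (s≤s z≤n)) (start₀ u)
  ; start₁     = trans (agree (s≤s (s≤s z≤n))) (start₁ u)
  ; end₀       = trans (right t) (end₀ v)
  ; end₁       = trans (right′ t) (end₁ v)
  }
  where
    col : ℕ → Column c
    col = prepend m (column u) (column v)

    agree : ∀ {x} → x < 2 + m → col x ≡ column u x
    agree = prepend-left m (column u) (column v)
              (trans (end₀ u) (sym (start₀ v))) (trans (end₁ u) (sym (start₁ v)))

    right : ∀ y → col (m + y) ≡ column v y
    right = prepend-right m (column u) (column v)

    right′ : ∀ y → col (suc (m + y)) ≡ column v (suc y)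
    right′ y = trans (cong col (sym (+-suc m y))) (right (suc y))

    compatible′ : ∀ {x} → x < m + t → CompatibleAt col x
    compatible′ {x} x<m+t with x <? m
    ... | yes x<m = compatible-cong (sym (agree x<2+m)) (sym (agree (s≤s x<1+m))) (sym (agree (s≤s (s≤s x<m))))
                      (compatible u x<m)
      where
        x<1+m : x < 1 + m
        x<1+m = m≤n⇒m≤1+n x<m
        x<2+m : x < 2 + m
        x<2+m = m≤n⇒m≤1+n x<1+m
    ... | no x≮m with m≤n⇒∃[o]m+o≡n (≮⇒≥ x≮m)
    ...   | y , refl = compatible-cong (sym (right y)) (sym (right′ y))
                         (sym (trans (cong (col ∘ suc) (sym (+-suc m y))) (right′ (suc y))))
                         (compatible v (+-cancelˡ-< m y t x<m+t))

checked : ∀ {c} n (col : ℕ → Column c) {_ : True (allUpTo? (compatibleAt? col) n)}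
  → col n ≡ col 0 → col (suc n) ≡ col 1 → CyclicWord c n (col 0) (col 1)
checked n col {ok} e₀ e₁ = record
  { column = col ; compatible = toWitness ok
  ; start₀ = refl ; start₁ = refl ; end₀ = e₀ ; end₁ = e₁ }

-- The standard pattern: row r of column i gets colour r + 2i (mod 5).
standard : ∀ {e} → ℕ → Column (5 + e)
standard 0 = # 0 ∷ # 1 ∷ # 2 ∷ # 3 ∷ # 4 ∷ []
standard 1 = # 2 ∷ # 3 ∷ # 4 ∷ # 0 ∷ # 1 ∷ []
standard 2 = # 4 ∷ # 0 ∷ # 1 ∷ # 2 ∷ # 3 ∷ []
standard 3 = # 1 ∷ # 2 ∷ # 3 ∷ # 4 ∷ # 0 ∷ []
standard 4 = # 3 ∷ # 4 ∷ # 0 ∷ # 1 ∷ # 2 ∷ []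
standard (suc (suc (suc (suc (suc i))))) = standard i

standard-word : ∀ {e} → CyclicWord (5 + e) 5 (standard 0) (standard 1)
standard-word = checked 5 standard refl refl

empty-word : ∀ {c a b} → CyclicWord c 0 a b
empty-word {a = a} {b} = record
  { column = λ { zero → a ; (suc _) → b } ; compatible = λ ()
  ; start₀ = refl ; start₁ = refl ; end₀ = refl ; end₁ = refl }

power : ∀ {c m a b} q → CyclicWord c m a b → CyclicWord c (q * m) a b
power zero    u = empty-word
power (suc q) u = glue u (power q u)

-- Each tailN starts with the first
-- two standard columns and returns to them after N columns, so it can be glued
-- to copies of the standard word; word6 and word7 colour C_5 □ C_6 and
-- C_5 □ C_7 on their own.  (Entries past position N + 1 are never read.)
tail8 : ℕ → Column 6
tail8 0 = # 0 ∷ # 1 ∷ # 2 ∷ # 3 ∷ # 4 ∷ []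
tail8 1 = # 2 ∷ # 3 ∷ # 4 ∷ # 0 ∷ # 1 ∷ []
tail8 2 = # 4 ∷ # 0 ∷ # 1 ∷ # 2 ∷ # 3 ∷ []
tail8 3 = # 1 ∷ # 2 ∷ # 3 ∷ # 4 ∷ # 5 ∷ []
tail8 4 = # 3 ∷ # 4 ∷ # 5 ∷ # 0 ∷ # 2 ∷ []
tail8 5 = # 5 ∷ # 0 ∷ # 1 ∷ # 3 ∷ # 4 ∷ []
tail8 6 = # 1 ∷ # 2 ∷ # 4 ∷ # 5 ∷ # 0 ∷ []
tail8 7 = # 3 ∷ # 5 ∷ # 0 ∷ # 1 ∷ # 2 ∷ []
tail8 8 = # 0 ∷ # 1 ∷ # 2 ∷ # 3 ∷ # 4 ∷ []
tail8 9 = # 2 ∷ # 3 ∷ # 4 ∷ # 0 ∷ # 1 ∷ []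
tail8 _ = # 0 ∷ # 1 ∷ # 2 ∷ # 3 ∷ # 4 ∷ []

tail9 : ℕ → Column 6
tail9 0 = # 0 ∷ # 1 ∷ # 2 ∷ # 3 ∷ # 4 ∷ []
tail9 1 = # 2 ∷ # 3 ∷ # 4 ∷ # 0 ∷ # 1 ∷ []
tail9 2 = # 4 ∷ # 0 ∷ # 1 ∷ # 2 ∷ # 3 ∷ []
tail9 3 = # 1 ∷ # 2 ∷ # 3 ∷ # 4 ∷ # 0 ∷ []
tail9 4 = # 3 ∷ # 4 ∷ # 0 ∷ # 1 ∷ # 5 ∷ []
tail9 5 = # 2 ∷ # 1 ∷ # 5 ∷ # 3 ∷ # 4 ∷ []
tail9 6 = # 5 ∷ # 0 ∷ # 4 ∷ # 2 ∷ # 1 ∷ []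
tail9 7 = # 4 ∷ # 2 ∷ # 3 ∷ # 5 ∷ # 0 ∷ []
tail9 8 = # 3 ∷ # 5 ∷ # 0 ∷ # 1 ∷ # 2 ∷ []
tail9 9 = # 0 ∷ # 1 ∷ # 2 ∷ # 3 ∷ # 4 ∷ []
tail9 10 = # 2 ∷ # 3 ∷ # 4 ∷ # 0 ∷ # 1 ∷ []
tail9 _ = # 0 ∷ # 1 ∷ # 2 ∷ # 3 ∷ # 4 ∷ []

tail11 : ℕ → Column 6
tail11 0 = # 0 ∷ # 1 ∷ # 2 ∷ # 3 ∷ # 4 ∷ []
tail11 1 = # 2 ∷ # 3 ∷ # 4 ∷ # 0 ∷ # 1 ∷ []
tail11 2 = # 4 ∷ # 0 ∷ # 1 ∷ # 2 ∷ # 3 ∷ []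
tail11 3 = # 1 ∷ # 2 ∷ # 3 ∷ # 4 ∷ # 0 ∷ []
tail11 4 = # 3 ∷ # 4 ∷ # 0 ∷ # 1 ∷ # 2 ∷ []
tail11 5 = # 0 ∷ # 1 ∷ # 2 ∷ # 3 ∷ # 4 ∷ []
tail11 6 = # 2 ∷ # 3 ∷ # 4 ∷ # 0 ∷ # 5 ∷ []
tail11 7 = # 4 ∷ # 0 ∷ # 5 ∷ # 2 ∷ # 1 ∷ []
tail11 8 = # 5 ∷ # 2 ∷ # 1 ∷ # 4 ∷ # 3 ∷ []
tail11 9 = # 1 ∷ # 4 ∷ # 3 ∷ # 5 ∷ # 0 ∷ []
tail11 10 = # 3 ∷ # 5 ∷ # 0 ∷ # 1 ∷ # 2 ∷ []
tail11 11 = # 0 ∷ # 1 ∷ # 2 ∷ # 3 ∷ # 4 ∷ []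
tail11 12 = # 2 ∷ # 3 ∷ # 4 ∷ # 0 ∷ # 1 ∷ []
tail11 _ = # 0 ∷ # 1 ∷ # 2 ∷ # 3 ∷ # 4 ∷ []

tail12 : ℕ → Column 6
tail12 0 = # 0 ∷ # 1 ∷ # 2 ∷ # 3 ∷ # 4 ∷ []
tail12 1 = # 2 ∷ # 3 ∷ # 4 ∷ # 0 ∷ # 1 ∷ []
tail12 2 = # 4 ∷ # 0 ∷ # 1 ∷ # 2 ∷ # 5 ∷ []
tail12 3 = # 1 ∷ # 2 ∷ # 5 ∷ # 3 ∷ # 0 ∷ []
tail12 4 = # 5 ∷ # 3 ∷ # 0 ∷ # 1 ∷ # 4 ∷ []
tail12 5 = # 0 ∷ # 1 ∷ # 4 ∷ # 5 ∷ # 3 ∷ []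
tail12 6 = # 4 ∷ # 5 ∷ # 3 ∷ # 0 ∷ # 2 ∷ []
tail12 7 = # 3 ∷ # 0 ∷ # 2 ∷ # 4 ∷ # 5 ∷ []
tail12 8 = # 2 ∷ # 4 ∷ # 5 ∷ # 3 ∷ # 1 ∷ []
tail12 9 = # 5 ∷ # 3 ∷ # 1 ∷ # 2 ∷ # 4 ∷ []
tail12 10 = # 1 ∷ # 2 ∷ # 4 ∷ # 5 ∷ # 0 ∷ []
tail12 11 = # 3 ∷ # 5 ∷ # 0 ∷ # 1 ∷ # 2 ∷ []
tail12 12 = # 0 ∷ # 1 ∷ # 2 ∷ # 3 ∷ # 4 ∷ []
tail12 13 = # 2 ∷ # 3 ∷ # 4 ∷ # 0 ∷ # 1 ∷ []
tail12 _ = # 0 ∷ # 1 ∷ # 2 ∷ # 3 ∷ # 4 ∷ []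

word6 : ℕ → Column 6
word6 0 = # 0 ∷ # 1 ∷ # 2 ∷ # 3 ∷ # 4 ∷ []
word6 1 = # 2 ∷ # 3 ∷ # 0 ∷ # 1 ∷ # 5 ∷ []
word6 2 = # 1 ∷ # 4 ∷ # 5 ∷ # 2 ∷ # 0 ∷ []
word6 3 = # 5 ∷ # 0 ∷ # 1 ∷ # 4 ∷ # 3 ∷ []
word6 4 = # 4 ∷ # 2 ∷ # 3 ∷ # 5 ∷ # 1 ∷ []
word6 5 = # 3 ∷ # 5 ∷ # 4 ∷ # 0 ∷ # 2 ∷ []
word6 6 = # 0 ∷ # 1 ∷ # 2 ∷ # 3 ∷ # 4 ∷ []
word6 7 = # 2 ∷ # 3 ∷ # 0 ∷ # 1 ∷ # 5 ∷ []
word6 _ = # 0 ∷ # 1 ∷ # 2 ∷ # 3 ∷ # 4 ∷ []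

word7 : ℕ → Column 7
word7 0 = # 0 ∷ # 1 ∷ # 2 ∷ # 3 ∷ # 4 ∷ []
word7 1 = # 2 ∷ # 3 ∷ # 4 ∷ # 0 ∷ # 1 ∷ []
word7 2 = # 4 ∷ # 0 ∷ # 1 ∷ # 5 ∷ # 6 ∷ []
word7 3 = # 1 ∷ # 5 ∷ # 6 ∷ # 2 ∷ # 3 ∷ []
word7 4 = # 6 ∷ # 2 ∷ # 3 ∷ # 4 ∷ # 5 ∷ []
word7 5 = # 3 ∷ # 4 ∷ # 5 ∷ # 6 ∷ # 0 ∷ []
word7 6 = # 5 ∷ # 6 ∷ # 0 ∷ # 1 ∷ # 2 ∷ []
word7 7 = # 0 ∷ # 1 ∷ # 2 ∷ # 3 ∷ # 4 ∷ []
word7 8 = # 2 ∷ # 3 ∷ # 4 ∷ # 0 ∷ # 1 ∷ []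
word7 _ = # 0 ∷ # 1 ∷ # 2 ∷ # 3 ∷ # 4 ∷ []

five-colourable : ∀ n → n % 5 ≡ 0 → Colourable (square (T5 n)) 5
five-colourable n 5∣n = subst (λ x → Colourable (square (T5 x)) 5) (sym n≡q·5)
  (word-colouring (power (n / 5) standard-word))
  where
    n≡q·5 : n ≡ n / 5 * 5
    n≡q·5 = trans (m≡m%n+[m/n]*n n 5) (cong (_+ n / 5 * 5) 5∣n)

seven-colourable : Colourable (square (T5 7)) 7
seven-colourable = word-colouring (checked 7 word7 refl refl)

-- Six colours: a tail word of length 6, 8, 9, 11 or 12 followed by copies of
-- the standard word covers every n ≥ 5 with n ≢ 0 (mod 5), except n = 7.
six-colourable : ∀ n → 5 ≤ n → n % 5 ≢ 0 → n ≢ 7 → Colourable (square (T5 n)) 6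
six-colourable n 5≤n 5∤n n≢7 = subst (λ x → Colourable (square (T5 x)) 6) (sym division)
  (by-residue (n % 5) (n / 5) (subst (5 ≤_) division 5≤n) (m%n<n n 5) 5∤n (n≢7 ∘ trans division))
  where
    division : n ≡ n % 5 + n / 5 * 5
    division = m≡m%n+[m/n]*n n 5
    by-residue : ∀ r q → 5 ≤ r + q * 5 → r < 5 → r ≢ 0 → r + q * 5 ≢ 7
      → Colourable (square (T5 (r + q * 5))) 6
    by-residue 0 q _ _ r≢0 _ = ⊥-elim (r≢0 refl)
    by-residue 1 0 (s≤s ()) _ _ _
    by-residue 1 1 _ _ _ _ = word-colouring (checked 6 word6 refl refl)
    by-residue 1 (suc (suc q)) _ _ _ _ = word-colouring (glue (checked 11 tail11 refl refl) (power q standard-word))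
    by-residue 2 0 (s≤s (s≤s ())) _ _ _
    by-residue 2 1 _ _ _ n≢7 = ⊥-elim (n≢7 refl)
    by-residue 2 (suc (suc q)) _ _ _ _ = word-colouring (glue (checked 12 tail12 refl refl) (power q standard-word))
    by-residue 3 0 (s≤s (s≤s (s≤s ()))) _ _ _
    by-residue 3 (suc q) _ _ _ _ = word-colouring (glue (checked 8 tail8 refl refl) (power q standard-word))
    by-residue 4 0 (s≤s (s≤s (s≤s (s≤s ())))) _ _ _
    by-residue 4 (suc q) _ _ _ _ = word-colouring (glue (checked 9 tail9 refl refl) (power q standard-word))
    by-residue (suc (suc (suc (suc (suc _))))) _ _ (s≤s (s≤s (s≤s (s≤s (s≤s ()))))) _ _

-- 5 is prime and divides neither jump, so it divides n whenever it divides s·n.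
jump-coprime : ∀ {s n} → IsJump s → 5 ∣ s * n → 5 ∣ n
jump-coprime {s} {n} s-jump 5∣s·n with euclidsLemma s n (from-yes (prime? 5)) 5∣s·n
... | inj₂ 5∣n = 5∣n
... | inj₁ 5∣s = ⊥-elim (5∤jump s-jump 5∣s)
  where
    5∤jump : ∀ {s} → IsJump s → ¬ (5 ∣ s)
    5∤jump (inj₁ refl) = from-no (5 ∣? 2)
    5∤jump (inj₂ refl) = from-no (5 ∣? 3)

disjoint-injections : ∀ {m m' n} (f : Fin m → Fin n) (g : Fin m' → Fin n)
  → Injective _≡_ _≡_ f → Injective _≡_ _≡_ g → (∀ x y → f x ≢ g y) → m + m' ≤ n
disjoint-injections {m} {m'} f g f-inj g-inj disjoint =
  injective⇒≤ {f = [ f , g ] ∘ splitAt m} λ {i} {i'} e → begin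
    i                         ≡⟨ join-splitAt m m' i ⟨
    join m m' (splitAt m i)   ≡⟨ cong (join m m') (sum-inj (splitAt m i) (splitAt m i') e) ⟩
    join m m' (splitAt m i')  ≡⟨ join-splitAt m m' i' ⟩
    i'                        ∎
  where
    open ≡-Reasoning
    sum-inj : ∀ a b → [ f , g ] a ≡ [ f , g ] b → a ≡ b
    sum-inj (inj₁ x) (inj₁ y) e = cong inj₁ (f-inj e)
    sum-inj (inj₁ x) (inj₂ y) e = ⊥-elim (disjoint x y e)
    sum-inj (inj₂ x) (inj₁ y) e = ⊥-elim (disjoint y x (sym e))
    sum-inj (inj₂ x) (inj₂ y) e = cong inj₂ (g-inj e)

module ColourClasses {k} (k≥2 : 2 ≤ k) {c} (χ : Colourable (square (T5 (suc k))) c) where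
  open Torus k

  colour : Vertex G → Fin c
  colour = proj₁ χ

  close-distinct : ∀ {u v} → Close u v → colour u ≢ colour v
  close-distinct uv = proj₂ χ _ _ (close⇒adj k≥2 uv)

  -- The five vertices of a column are pairwise close, so get five colours.
  column-injective : ∀ j → Injective _≡_ _≡_ (λ r → colour (r , j))
  column-injective j {r} {r'} e with r ≟ᶠ r'
  ... | yes r≡r' = r≡r'
  ... | no  r≢r' = ⊥-elim (close-distinct (same-column r≢r') e)

  at-least-five : 5 ≤ c
  at-least-five = injective⇒≤ (column-injective zero)

  Missing : Fin c → Fin N → Set
  Missing κ j = ∀ r → colour (r , j) ≢ κ

  missing? : ∀ κ j → Dec (Missing κ j)
  missing? κ j = all? λ r → ¬? (colour (r , j) ≟ᶠ κ)

  present-or-missing : ∀ κ j → (∃ λ r → colour (r , j) ≡ κ) ⊎ Missing κ j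
  present-or-missing κ j with any? (λ r → colour (r , j) ≟ᶠ κ)
  ... | yes present = inj₁ present
  ... | no  absent  = inj₂ λ r e → absent (r , e)

  -- The row of colour κ in column j (row 0 if κ is missing there).
  row-of : Fin c → Fin N → Fin 5
  row-of κ j with present-or-missing κ j
  ... | inj₁ (r , _) = r
  ... | inj₂ _       = zero

  row-of-spec : ∀ κ j → ¬ Missing κ j → colour (row-of κ j , j) ≡ κ
  row-of-spec κ j not-missing with present-or-missing κ j
  ... | inj₁ (_ , e)  = e
  ... | inj₂ missing  = ⊥-elim (not-missing missing)

  missing⇒six : ∀ {κ j} → Missing κ j → 5 + 1 ≤ c
  missing⇒six {κ} {j} missing =
    disjoint-injections _ (λ _ → κ) (column-injective j) (λ { {zero} {zero} _ → refl }) λ r _ → missing r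

  two-missing⇒seven : ∀ {κ κ' j} → κ ≢ κ' → Missing κ j → Missing κ' j → 5 + 2 ≤ c
  two-missing⇒seven {κ} {κ'} {j} κ≢κ' missing missing' =
    disjoint-injections _ pair (column-injective j) pair-injective avoids
    where
      pair : Fin 2 → Fin c
      pair zero = κ
      pair (suc _) = κ'
      pair-injective : Injective _≡_ _≡_ pair
      pair-injective {zero}       {zero}       _ = refl
      pair-injective {zero}       {suc zero}   e = ⊥-elim (κ≢κ' e)
      pair-injective {suc zero}   {zero}       e = ⊥-elim (κ≢κ' (sym e))
      pair-injective {suc zero}   {suc zero}   _ = refl
      avoids : ∀ r x → colour (r , j) ≢ pair x
      avoids r zero = missing r
      avoids r (suc zero) = missing' r

  class-walk : ∀ κ j m (row : ℕ → Fin 5) → (∀ i → i ≤ m → colour (row i , (next ^ i) j) ≡ κ)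
    → Σ ℕ λ s → IsJump s × (∀ i → i ≤ m → row i ≡ rotate (s * i) (row 0))
  class-walk κ j m row on = uniform-jump m row far apart
    where
      far : ∀ i → i < m → ¬ Near (row i) (row (suc i))
      far i i<m near = close-distinct (next-column near) (trans (on i (≤-trans (n≤1+n i) i<m)) (sym (on (suc i) i<m)))
      apart : ∀ i → suc i < m → row i ≢ row (suc (suc i))
      apart i i+2≤m same = close-distinct second-column (trans (on i i≤m) (sym κ-two-later))
        where
          i≤m = ≤-trans (n≤1+n i) (≤-trans (n≤1+n (suc i)) i+2≤m)
          κ-two-later : colour (row i , (next ^ suc (suc i)) j) ≡ κ
          κ-two-later = subst (λ r → colour (r , (next ^ suc (suc i)) j) ≡ κ) (sym same) (on (suc (suc i)) i+2≤m)

-- In a 5-colouring every column uses all colours, so the class of one colour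
-- meets every column; walking once around C_N its row advances by N·s with
-- s ∈ {2, 3} and comes back, hence 5 ∣ s·N and so 5 ∣ N.
five-colouring⇒5∣N : ∀ {k} → 2 ≤ k → Colourable (square (T5 (suc k))) 5 → suc k % 5 ≡ 0
five-colouring⇒5∣N {k} k≥2 χ = n∣m⇒m%n≡0 _ 5 (jump-coprime (proj₁ (proj₂ walk)) 5∣s·N)
  where
    open Torus k
    open ColourClasses k≥2 χ
    κ : Fin 5
    κ = colour (zero , zero)
    everywhere : ∀ j → ¬ Missing κ j
    everywhere j missing = 1+n≰n (missing⇒six missing)
    row : ℕ → Fin 5
    row i = row-of κ ((next ^ i) zero)
    walk : Σ ℕ λ s → IsJump s × (∀ i → i ≤ N → row i ≡ rotate (s * i) (row 0))
    walk = class-walk κ zero N row (λ i _ → row-of-spec κ _ (everywhere _))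
    s : ℕ
    s = proj₁ walk
    returns : rotate (s * N) (row 0) ≡ row 0
    returns = trans (sym (proj₂ (proj₂ walk) N ≤-refl)) (cong (row-of κ) (next^-N zero))
    5∣s·N : 5 ∣ s * N
    5∣s·N = m%n≡0⇒n∣m _ 5 (Row.next^-fixed (s * N) (row 0) returns)

-- A colour present in all columns
-- but one occupies six consecutive columns; its rows advance by 5·s, i.e. not
-- at all, so the first and the last of these columns (two apart in C_7) would
-- repeat a row.  Hence every colour misses two columns; but a column misses at
-- most one of the six colours, and 6 · 2 missing pairs do not fit into 7 columns.
module SixColouringOf7 (χ : Colourable (square (T5 7)) 6) where
  open Torus 6
  open ColourClasses (s≤s (s≤s z≤n)) χ

  not-almost-everywhere : ∀ κ j₀ → (∀ j → j ≢ j₀ → ¬ Missing κ j) → ⊥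
  not-almost-everywhere κ j₀ present = close-distinct second-column (trans on-last (sym on-first))
    where
      j₁ : Fin 7
      j₁ = next j₀
      away : ∀ i → i ≤ 5 → (next ^ i) j₁ ≢ j₀
      away i i≤5 e = next^-moves (i + 1) j₀ (m≤n+m 1 i) (s≤s (+-monoˡ-≤ 1 i≤5))
                       (trans (cong-app (^-homo next i 1) j₀) e)
      row : ℕ → Fin 5
      row i = row-of κ ((next ^ i) j₁)
      walk : Σ ℕ λ s → IsJump s × (∀ i → i ≤ 5 → row i ≡ rotate (s * i) (row 0))
      walk = class-walk κ j₁ 5 row λ i i≤5 → row-of-spec κ _ (present _ (away i i≤5))
      same-row : row 5 ≡ row 0
      same-row = trans (proj₂ (proj₂ walk) 5 ≤-refl) (Row.next^-multiple (proj₁ walk) (row 0))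
      on-last : colour (row 0 , (next ^ 5) j₁) ≡ κ
      on-last = subst (λ r → colour (r , (next ^ 5) j₁) ≡ κ) same-row
                  (row-of-spec κ _ (present _ (away 5 ≤-refl)))
      -- two columns after the last one we are back at j₁ = next^7 j₁
      on-first : colour (row 0 , next (next ((next ^ 5) j₁))) ≡ κ
      on-first = subst (λ j → colour (row 0 , j) ≡ κ) (sym (next^-N j₁))
                   (row-of-spec κ _ (present _ (away 0 z≤n)))

  TwoMissing : Fin 6 → Set
  TwoMissing κ = ∃ λ j → ∃ λ j' → j ≢ j' × Missing κ j × Missing κ j'

  -- (Kept opaque so that the finite searches inside are never unfolded.)
  opaque
    two-missing : ∀ κ → TwoMissing κ
    two-missing κ with any? (λ j → any? λ j' → ¬? (j ≟ᶠ j') ×-dec missing? κ j ×-dec missing? κ j')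
    ... | yes two = two
    ... | no none with any? (missing? κ)
    ...   | yes (j₀ , m₀) = ⊥-elim (not-almost-everywhere κ j₀ λ j j≢j₀ m → none (j , j₀ , j≢j₀ , m , m₀))
    ...   | no nothing    = ⊥-elim (not-almost-everywhere κ zero λ j _ m → nothing (j , m))

  first second : Fin 6 → Fin 7
  first  κ = proj₁ (two-missing κ)
  second κ = proj₁ (proj₂ (two-missing κ))

  first-missing : ∀ κ → Missing κ (first κ)
  first-missing κ = proj₁ (proj₂ (proj₂ (proj₂ (two-missing κ))))
  second-missing : ∀ κ → Missing κ (second κ)
  second-missing κ = proj₂ (proj₂ (proj₂ (proj₂ (two-missing κ))))

  one-missing : ∀ {κ κ' j} → Missing κ j → Missing κ' j → κ ≡ κ'
  one-missing {κ} {κ'} m m' with κ ≟ᶠ κ'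
  ... | yes e = e
  ... | no κ≢κ' = ⊥-elim (1+n≰n (two-missing⇒seven κ≢κ' m m'))

  first-injective : Injective _≡_ _≡_ first
  first-injective {κ} {κ'} e = one-missing (first-missing κ) (subst (Missing κ') (sym e) (first-missing κ'))
  second-injective : Injective _≡_ _≡_ second
  second-injective {κ} {κ'} e = one-missing (second-missing κ) (subst (Missing κ') (sym e) (second-missing κ'))
  disjoint : ∀ κ κ' → first κ ≢ second κ'
  disjoint κ κ' e with one-missing (first-missing κ) (subst (Missing κ') (sym e) (second-missing κ'))
  ... | refl = proj₁ (proj₂ (proj₂ (two-missing κ))) e

  contradiction : ⊥
  contradiction = <⇒≱ (m<m+n 7 (s≤s z≤n)) (disjoint-injections first second first-injective second-injective disjoint)

no-six-colouring-7 : ¬ Colourable (square (T5 7)) 6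
no-six-colouring-7 χ = SixColouringOf7.contradiction χ

chromatic : ∀ {G c} → Colourable G c → (∀ m → Colourable G m → c ≤ m) → ChromaticNumber G c
chromatic colourable lower = colourable , λ m m<c χ → <⇒≱ m<c (lower m χ)

step-up : ∀ {G c} → (∀ m → Colourable G m → c ≤ m) → ¬ Colourable G c
  → ∀ m → Colourable G m → suc c ≤ m
step-up lower not-c m χ with m≤n⇒m<n∨m≡n (lower m χ)
... | inj₁ c<m  = c<m
... | inj₂ refl = ⊥-elim (not-c χ)

at-least-five-colours : ∀ {k} → 2 ≤ k → ∀ m → Colourable (square (T5 (suc k))) m → 5 ≤ m
at-least-five-colours k≥2 _ χ = ColourClasses.at-least-five k≥2 χ

at-least-six-colours : ∀ {k} → 2 ≤ k → suc k % 5 ≢ 0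
  → ∀ m → Colourable (square (T5 (suc k))) m → 6 ≤ m
at-least-six-colours k≥2 5∤n = step-up (at-least-five-colours k≥2) (5∤n ∘ five-colouring⇒5∣N k≥2)

chromatic-7 : ChromaticNumber (square (T5 7)) 7
chromatic-7 = chromatic seven-colourable
  (step-up (at-least-six-colours (s≤s (s≤s z≤n)) λ ()) no-six-colouring-7)

theorem7 : (n : ℕ) → 5 ≤ n →
    (n % 5 ≡ 0 → ChromaticNumber (square (T5 n)) 5)
    × (n ≡ 7 → ChromaticNumber (square (T5 n)) 7)
    × (¬ (n % 5 ≡ 0) → ¬ (n ≡ 7) → ChromaticNumber (square (T5 n)) 6)
theorem7 n@(suc k) 5≤n@(s≤s 4≤k) =
    (λ 5∣n → chromatic (five-colourable n 5∣n) (at-least-five-colours k≥2))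
  , (λ n≡7 → subst (λ x → ChromaticNumber (square (T5 x)) 7) (sym n≡7) chromatic-7)
  , (λ 5∤n n≢7 → chromatic (six-colourable n 5≤n 5∤n n≢7) (at-least-six-colours k≥2 5∤n))
  where
    k≥2 : 2 ≤ k
    k≥2 = ≤-trans (s≤s (s≤s z≤n)) 4≤k
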